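{- Let $\delta$ be a positive integer, $k$ an even positive integer, and $G$ a graph of odd order $n \geq 3$ with minimum degree $\delta(G) \geq \delta$. (i) If $n > 6\delta-1$ and $e(G) \geq e(K_\delta \vee (K_{n-2\delta} + \overline{K_\delta}))$, then $G$ is $\mathrm{GFC}_k$ unless $G = K_\delta \vee (K_{n-2\delta} + \overline{K_\delta})$. (ii) If $n = 6\delta-1$ and $e(G) \geq e(K_\delta \vee (K_{n-2\delta} + \overline{K_\delta}))$, then $G$ is $\mathrm{GFC}_k$ unless $G = K_\delta \vee (K_{n-2\delta} + \overline{K_\delta})$ or $G = K_{(n-1)/2} \vee \overline{K_{(n+1)/2}}$. (iii) If $n < 6\delta-1$ and $e(G) \geq e(K_{(n-1)/2} \vee \overline{K_{(n+1)/2}})$, then $G$ is $\mathrm{GFC}_k$ unless $G = K_{(n-1)/2} \vee \overline{K_{(n+1)/2}}$.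
   Context: All graphs are finite, simple, undirected and connected; $G = H$ means isomorphism. $e(G)$ is the number of edges, $\delta(G)$ the minimum degree. $K_m$ is the complete graph, $\overline{K_m}$ the edgeless graph on $m$ vertices, $+$ disjoint union, $\vee$ join. For $S \subseteq V(G)$, $G-S$ is obtained by deleting $S$; $i(G-S)$ is the number of isolated vertices of $G-S$ and $\mathrm{odd}(G-S)$ the number of nontrivial (at least 2 vertices) components of $G-S$ of odd order. Define, over all $S \subseteq V(G)$, the quantity $\phi_k(S) = k\cdot i(G-S) - k|S|$ if $k$ is even and $\phi_k(S) = \mathrm{odd}(G-S) + k\cdot i(G-S) - k|S|$ if $k$ is odd; $\mathrm{def}_k(G) = \max_{S \subseteq V(G)} \phi_k(S)$, and a set $S$ attaining this maximum is a $k$-barrier. A graph of odd order is generalized factor-critical ($\mathrm{GFC}_k$) if $\varnothing$ is its only $k$-barrier. -}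

module Defs where

open import Data.Bool using (Bool; true; false; _∧_; _∨_; not; if_then_else_)
open import Data.Nat using (ℕ; zero; suc; _+_; _*_; _∸_; _≤_; _<_; _≤ᵇ_; _<ᵇ_; _/_; _%_)
open import Data.Fin using (Fin; toℕ; _≟_)
import Data.Fin as F
open import Data.Fin.Subset using (Subset; ⊥)
open import Data.Vec using (lookup)
open import Data.Integer using (ℤ; +_; _-_) renaming (_+_ to _+ℤ_; _*_ to _*ℤ_; _≤_ to _≤ℤ_)
open import Data.Product using (Σ; _×_)
open import Function.Bundles using (_↔_; Inverse)
open import Relation.Binary.PropositionalEquality using (_≡_; refl)
open import Relation.Nullary using (¬_; yes; no)
open import Relation.Nullary.Decidable using (⌊_⌋)
open import Data.Nat.Divisibility using (_∣_)

record Graph (n : ℕ) : Set where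
  field
    adj    : Fin n → Fin n → Bool
    sym    : ∀ u v → adj u v ≡ adj v u
    irrefl : ∀ v → adj v v ≡ false
open Graph public

count : ∀ {n} → (Fin n → Bool) → ℕ
count {zero}  p = 0
count {suc n} p = (if p F.zero then 1 else 0) + count (λ i → p (F.suc i))

anyF : ∀ {n} → (Fin n → Bool) → Bool
anyF {zero}  p = false
anyF {suc n} p = p F.zero ∨ anyF (λ i → p (F.suc i))

allF : ∀ {n} → (Fin n → Bool) → Bool
allF p = not (anyF (λ i → not (p i)))

eqB : ∀ {n} → Fin n → Fin n → Bool
eqB u v = ⌊ u ≟ v ⌋

data Walk {n : ℕ} (G : Graph n) : Fin n → Fin n → Set where
  here : ∀ {v} → Walk G v v
  step : ∀ {u w v} → adj G u w ≡ true → Walk G w v → Walk G u v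

Connected : ∀ {n} → Graph n → Set
Connected G = ∀ u v → Walk G u v

degree : ∀ {n} → Graph n → Fin n → ℕ
degree G v = count (adj G v)

MinDegreeAtLeast : ∀ {n} → Graph n → ℕ → Set
MinDegreeAtLeast G d = ∀ v → d ≤ degree G v

edges : ∀ {n} → Graph n → ℕ
edges G = sumF (λ u → count (λ v → (toℕ u <ᵇ toℕ v) ∧ adj G u v))
  where
  sumF : ∀ {n} → (Fin n → ℕ) → ℕ
  sumF {zero}  f = 0
  sumF {suc n} f = f F.zero + sumF (λ i → f (F.suc i))

Iso : ∀ {n} → Graph n → Graph n → Set
Iso {n} G H = Σ (Fin n ↔ Fin n) λ f →
  ∀ u v → adj G u v ≡ adj H (Inverse.to f u) (Inverse.to f v)

inS : ∀ {n} → Subset n → Fin n → Bool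
inS S v = lookup S v

reachB : ∀ {n} → Graph n → Subset n → ℕ → Fin n → Fin n → Bool
reachB G S zero    u v = not (inS S u) ∧ eqB u v
reachB G S (suc m) u v =
  reachB G S m u v ∨ anyF (λ w → reachB G S m u w ∧ adj G w v ∧ not (inS S v))

-- u, v in the same component of G - S (walks of length < n suffice)
sameComp : ∀ {n} → Graph n → Subset n → Fin n → Fin n → Bool
sameComp {n} G S = reachB G S n

compSize : ∀ {n} → Graph n → Subset n → Fin n → ℕ
compSize G S v = count (sameComp G S v)

-- v is the least vertex of its component of G - S (a canonical representative)
isRep : ∀ {n} → Graph n → Subset n → Fin n → Bool
isRep G S v = not (inS S v) ∧ allF (λ u → not ((toℕ u <ᵇ toℕ v) ∧ sameComp G S v u))

oddB : ℕ → Bool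
oddB m = eqℕ (m % 2) 1
  where
  eqℕ : ℕ → ℕ → Bool
  eqℕ a b = (a ≤ᵇ b) ∧ (b ≤ᵇ a)

oddComps : ∀ {n} → Graph n → Subset n → ℕ
oddComps G S = count (λ v → isRep G S v ∧ (2 ≤ᵇ compSize G S v) ∧ oddB (compSize G S v))

isolated : ∀ {n} → Graph n → Subset n → ℕ
isolated G S = count (λ v → not (inS S v) ∧ allF (λ u → inS S u ∨ not (adj G v u)))

card : ∀ {n} → Subset n → ℕ
card S = count (inS S)

φ : ∀ {n} → ℕ → Graph n → Subset n → ℤ
φ k G S = if oddB k
  then (+ oddComps G S) +ℤ (+ (k * isolated G S)) - (+ (k * card S))
  else (+ (k * isolated G S)) - (+ (k * card S))

IsBarrier : ∀ {n} → ℕ → Graph n → Subset n → Set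
IsBarrier k G S = ∀ T → φ k G T ≤ℤ φ k G S

GFC : ∀ {n} → ℕ → Graph n → Set
GFC {n} k G = ¬ (2 ∣ n) × IsBarrier k G ⊥ × (∀ S → IsBarrier k G S → S ≡ ⊥)

private
  neq-refl : ∀ {n} (v : Fin n) → not (eqB v v) ≡ false
  neq-refl v with v ≟ v
  ... | yes _ = refl
  ... | no ¬p = Data.Empty.⊥-elim (¬p refl)
    where import Data.Empty

  eqB-sym : ∀ {n} (u v : Fin n) → eqB u v ≡ eqB v u
  eqB-sym u v with u ≟ v | v ≟ u
  ... | yes _ | yes _ = refl
  ... | no _  | no _  = refl
  ... | yes p | no ¬q = Data.Empty.⊥-elim (¬q (Relation.Binary.PropositionalEquality.sym p))
    where import Data.Empty
  ... | no ¬p | yes q = Data.Empty.⊥-elim (¬p (Relation.Binary.PropositionalEquality.sym q))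
    where import Data.Empty

  ∨-comm : ∀ a b → (a ∨ b) ≡ (b ∨ a)
  ∨-comm false false = refl
  ∨-comm false true  = refl
  ∨-comm true  false = refl
  ∨-comm true  true  = refl

  ∧-comm : ∀ a b → (a ∧ b) ≡ (b ∧ a)
  ∧-comm false false = refl
  ∧-comm false true  = refl
  ∧-comm true  false = refl
  ∧-comm true  true  = refl

mkGraph : ∀ {n} (P : Fin n → Fin n → Bool) → (∀ u v → P u v ≡ P v u) → Graph n
mkGraph P Psym = record
  { adj = λ u v → not (eqB u v) ∧ P u v
  ; sym = λ u v → helper u v
  ; irrefl = λ v → irr v
  }
  where
  open Relation.Binary.PropositionalEquality using (cong₂)
  helper : ∀ u v → (not (eqB u v) ∧ P u v) ≡ (not (eqB v u) ∧ P v u)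
  helper u v = cong₂ (λ a b → not a ∧ b) (eqB-sym u v) (Psym u v)
  irr : ∀ v → (not (eqB v v) ∧ P v v) ≡ false
  irr v rewrite neq-refl v = refl

-- K_d ∨ (K_{n-2d} + \overline{K_d}):
-- vertices 0..d-1 form K_d (joined to everything),
-- vertices d..n-d-1 form K_{n-2d}, vertices n-d..n-1 are independent.
Kjoin : (n d : ℕ) → Graph n
Kjoin n d = mkGraph P Psym
  where
  A : Fin n → Bool
  A v = toℕ v <ᵇ d
  B : Fin n → Bool
  B v = not (A v) ∧ (toℕ v <ᵇ (n ∸ d))
  P : Fin n → Fin n → Bool
  P u v = (A u ∨ A v) ∨ (B u ∧ B v)
  Psym : ∀ u v → P u v ≡ P v u
  Psym u v = Relation.Binary.PropositionalEquality.cong₂ _∨_ (∨-comm (A u) (A v)) (∧-comm (B u) (B v))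

-- K_{(n-1)/2} ∨ \overline{K_{(n+1)/2}}: vertices 0..(n-1)/2-1 form the clique
Ksplit : (n : ℕ) → Graph n
Ksplit n = mkGraph P Psym
  where
  A : Fin n → Bool
  A v = toℕ v <ᵇ ((n ∸ 1) / 2)
  P : Fin n → Fin n → Bool
  P u v = A u ∨ A v
  Psym : ∀ u v → P u v ≡ P v u
  Psym u v = ∨-comm (A u) (A v)

{-# OPTIONS --safe #-}
module Submission where

-- For even k, φ_k(S) = k (i(G − S) − |S|) and φ_k(∅) = 0 as δ ≥ 1, so G is GFC_k unless some
-- S ≠ ∅ has i(G − S) ≥ |S| = s. Then δ ≤ s, and if I is a set of s isolated vertices of G − S,
-- no pair of V ∖ S meeting I is an edge: G is a spanning subgraph of a relabelled
-- K_s ∨ (K_r + \overline{K_s}), r = n − 2s, and misses at least C(s,2) + s·r edges. On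
-- δ ≤ s ≤ (n − 1)/2 this count is concave in s, so the edge hypothesis, which bounds it by its
-- value at s = δ in (i), (ii) and at s = (n − 1)/2 in (iii), pins s to that end (to either end
-- in (ii)) and makes G the whole join, which is the excluded extremal graph.

open import Defs hiding (sym)
open import Data.Nat using (ℕ; _*_; _∸_; _≤_; _<_)
open import Data.Nat.Divisibility using (_∣_)
open import Data.Product using (_×_)
open import Relation.Binary.PropositionalEquality using (_≡_)
open import Relation.Nullary using (¬_)

open import Data.Bool using (Bool; true; false; _∧_; _∨_; not)
open import Data.Bool.Properties
  using (∧-comm; ∧-zeroʳ; ∨-comm; ∨-identityʳ; not-involutive; not-injective)
open import Data.Fin using (Fin; zero; suc; toℕ; fromℕ; fromℕ<; punchIn)
open import Data.Fin.Permutation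
  using (Permutation; insert; _⟨$⟩ʳ_; _⟨$⟩ˡ_; inverseˡ; insert-punchIn)
import Data.Fin.Permutation as Permutation
open import Data.Fin.Properties using (_≟_; toℕ-injective; toℕ-fromℕ; toℕ-fromℕ<)
open import Data.Fin.Subset using (Subset) renaming (⊥ to ∅)
import Data.Integer as ℤ
open import Data.Integer.Properties using (i≤j⇒i-j≤0; 0≤i-j⇒j≤i; drop‿+≤+)
open import Data.Nat using (zero; suc; _+_; _<ᵇ_; z≤n; s≤s; s≤s⁻¹; >-nonZero)
open import Data.Nat.Combinatorics using (_C_; nC1≡n; nCk+nC[k+1]≡[n+1]C[k+1])
open import Data.Nat.DivMod using (_/_; _%_; m*n/n≡m; m%n<n; m≡m%n+[m/n]*n)
open import Data.Nat.Divisibility using (divides; n∣m⇒m%n≡0)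
open import Data.Nat.Properties hiding (_≟_)
open import Data.Nat.Tactic.RingSolver using (solve-∀)
open import Data.Product using (Σ; ∃-syntax; _,_; proj₁; proj₂)
open import Data.Sum using (_⊎_; inj₁; inj₂; [_,_]′)
open import Data.Vec using (tabulate; lookup)
open import Data.Vec.Functional using (_∷_)
open import Data.Vec.Properties using (lookup-replicate; tabulate∘lookup; tabulate-cong)
open import Function using (_∘_)
open import Relation.Binary.Definitions using (tri<; tri≈; tri>)
open import Relation.Binary.PropositionalEquality
  using (_≢_; refl; sym; trans; cong; cong₂; subst; subst₂; module ≡-Reasoning)
open import Relation.Nullary using (yes; no; contradiction)

∧≡true : ∀ {a b} → a ∧ b ≡ true → a ≡ true × b ≡ true
∧≡true {true} {true} _ = refl , refl

∨≡true : ∀ {a b} → a ∨ b ≡ true → a ≡ true ⊎ b ≡ true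
∨≡true {true}         _ = inj₁ refl
∨≡true {false} {true} _ = inj₂ refl

∨≡false : ∀ {a b} → a ∨ b ≡ false → a ≡ false × b ≡ false
∨≡false {false} {false} _ = refl , refl

not-antitone : ∀ {a b} → (a ≡ true → b ≡ true) → not b ≡ true → not a ≡ true
not-antitone {false} _   _  = refl
not-antitone {true}  a⇒b nb = subst (λ x → not x ≡ true) (a⇒b refl) nb

<⇒<ᵇ≡true : ∀ {m n} → m < n → (m <ᵇ n) ≡ true
<⇒<ᵇ≡true {zero}  {suc n} _         = refl
<⇒<ᵇ≡true {suc m} {suc n} (s≤s m<n) = <⇒<ᵇ≡true m<n

≥⇒<ᵇ≡false : ∀ {m n} → n ≤ m → (m <ᵇ n) ≡ false
≥⇒<ᵇ≡false {n = zero}      _         = refl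
≥⇒<ᵇ≡false {suc m} {suc n} (s≤s n≤m) = ≥⇒<ᵇ≡false n≤m

<ᵇ≡true⇒< : ∀ m n → (m <ᵇ n) ≡ true → m < n
<ᵇ≡true⇒< zero    (suc n) _  = s≤s z≤n
<ᵇ≡true⇒< (suc m) (suc n) eq = s≤s (<ᵇ≡true⇒< m n eq)

<ᵇ≡false⇒≥ : ∀ m n → (m <ᵇ n) ≡ false → n ≤ m
<ᵇ≡false⇒≥ m       zero    _  = z≤n
<ᵇ≡false⇒≥ (suc m) (suc n) eq = s≤s (<ᵇ≡false⇒≥ m n eq)

-- Counting vertices

infix 4 _⊆ᵇ_

_⊆ᵇ_ : ∀ {n} → (Fin n → Bool) → (Fin n → Bool) → Set
p ⊆ᵇ q = ∀ v → p v ≡ true → q v ≡ true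

below : ∀ {n} → ℕ → Fin n → Bool
below d v = toℕ v <ᵇ d

count-≤ : ∀ {n} (p : Fin n → Bool) → count p ≤ n
count-≤ {zero}  p = z≤n
count-≤ {suc n} p with p zero
... | true  = s≤s (count-≤ (p ∘ suc))
... | false = m≤n⇒m≤1+n (count-≤ (p ∘ suc))

count-mono : ∀ {n} {p q : Fin n → Bool} → p ⊆ᵇ q → count p ≤ count q
count-mono {zero}          _   = z≤n
count-mono {suc n} {p} {q} p⊆q with p zero in eqp | q zero in eqq
... | true  | true  = s≤s (count-mono (p⊆q ∘ suc))
... | true  | false = contradiction (trans (sym (p⊆q zero eqp)) eqq) λ ()
... | false | true  = m≤n⇒m≤1+n (count-mono (p⊆q ∘ suc))
... | false | false = count-mono (p⊆q ∘ suc)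

count-cong : ∀ {n} {p q : Fin n → Bool} → (∀ v → p v ≡ q v) → count p ≡ count q
count-cong p≗q = ≤-antisym (count-mono λ v eq → trans (sym (p≗q v)) eq)
                           (count-mono λ v eq → trans (p≗q v) eq)

count-false : ∀ n → count {n} (λ _ → false) ≡ 0
count-false zero    = refl
count-false (suc n) = count-false n

count-true : ∀ n → count {n} (λ _ → true) ≡ n
count-true zero    = refl
count-true (suc n) = cong suc (count-true n)

count≡0⇒false : ∀ {n} (p : Fin n → Bool) → count p ≡ 0 → ∀ v → p v ≡ false
count≡0⇒false {suc n} p eq v with p zero in eq₀
count≡0⇒false {suc n} p eq zero    | false = eq₀
count≡0⇒false {suc n} p eq (suc v) | false = count≡0⇒false (p ∘ suc) eq v

count>0⇒∃ : ∀ {n} (p : Fin n → Bool) → 0 < count p → ∃[ v ] p v ≡ true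
count>0⇒∃ {suc n} p pos with p zero in eq₀
... | true  = zero , eq₀
... | false = let v , pv = count>0⇒∃ (p ∘ suc) pos in suc v , pv

count-split : ∀ {n} (p q : Fin n → Bool) →
  count p ≡ count (λ v → p v ∧ q v) + count (λ v → p v ∧ not (q v))
count-split {zero}  p q = refl
count-split {suc n} p q with p zero | q zero
... | true  | true  = cong suc (count-split (p ∘ suc) (q ∘ suc))
... | true  | false = trans (cong suc (count-split (p ∘ suc) (q ∘ suc))) (sym (+-suc _ _))
... | false | _     = count-split (p ∘ suc) (q ∘ suc)

count-+-count-not : ∀ {n} (p : Fin n → Bool) → count p + count (not ∘ p) ≡ n
count-+-count-not {n} p = trans (sym (count-split (λ _ → true) p)) (count-true n)

count-⊆ : ∀ {n} {p q : Fin n → Bool} → q ⊆ᵇ p →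
  count p ≡ count q + count (λ v → p v ∧ not (q v))
count-⊆ {p = p} {q} q⊆p =
  trans (count-split p q) (cong (_+ count (λ v → p v ∧ not (q v))) (count-cong p∧q≡q))
  where
  p∧q≡q : ∀ v → p v ∧ q v ≡ q v
  p∧q≡q v with q v in eq
  ... | true  = cong (_∧ true) (q⊆p v eq)
  ... | false = ∧-zeroʳ (p v)

count-disjoint : ∀ {n} {S I : Fin n → Bool} → I ⊆ᵇ not ∘ S → count S + count I ≤ n
count-disjoint {n} {S} {I} I⊆∁S = begin
  count S + count I         ≤⟨ +-monoʳ-≤ (count S) (count-mono I⊆∁S) ⟩
  count S + count (not ∘ S) ≡⟨ count-+-count-not S ⟩
  n                         ∎
  where open ≤-Reasoning

count-below : ∀ {n} d → d ≤ n → count {n} (below d) ≡ d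
count-below {zero}  zero    _         = refl
count-below {suc n} zero    _         = count-false n
count-below {suc n} (suc d) (s≤s d≤n) = cong suc (count-below d d≤n)

shrink : ∀ {n} (p : Fin n → Bool) k → k ≤ count p → ∃[ q ] q ⊆ᵇ p × count q ≡ k
shrink {n}     p zero    _ = (λ _ → false) , (λ _ ()) , count-false n
shrink {suc n} p (suc k) k<|p| with p zero in eq₀
shrink {suc n} p (suc k) (s≤s k≤|p′|) | true =
  let q′ , q′⊆p′ , |q′| = shrink (p ∘ suc) k k≤|p′| in
  (true ∷ q′) , (λ { zero _ → eq₀ ; (suc v) → q′⊆p′ v }) , cong suc |q′|
shrink {suc n} p (suc k) k<|p′| | false =
  let q′ , q′⊆p′ , |q′| = shrink (p ∘ suc) (suc k) k<|p′| in
  (false ∷ q′) , (λ { zero () ; (suc v) → q′⊆p′ v }) , |q′|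

anyF≡false : ∀ {n} (p : Fin n → Bool) → anyF p ≡ false → ∀ v → p v ≡ false
anyF≡false p eq zero    = proj₁ (∨≡false eq)
anyF≡false p eq (suc v) = anyF≡false (p ∘ suc) (proj₂ (∨≡false {p zero} eq)) v

allF≡true : ∀ {n} (p : Fin n → Bool) → allF p ≡ true → ∀ v → p v ≡ true
allF≡true p eq v = not-injective (anyF≡false (not ∘ p) (not-injective eq) v)

-- Counting pairs

pairCount : ∀ {n} → (Fin n → Fin n → Bool) → ℕ
pairCount {zero}  R = 0
pairCount {suc n} R = count (R zero ∘ suc) + pairCount (λ u v → R (suc u) (suc v))

infix 4 _⊆<_

_⊆<_ : ∀ {n} → (Fin n → Fin n → Bool) → (Fin n → Fin n → Bool) → Set
R ⊆< R′ = ∀ u v → toℕ u < toℕ v → R u v ≡ true → R′ u v ≡ true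

pairCount-mono : ∀ {n} {R R′ : Fin n → Fin n → Bool} → R ⊆< R′ → pairCount R ≤ pairCount R′
pairCount-mono {zero}  _    = z≤n
pairCount-mono {suc n} R⊆R′ =
  +-mono-≤ (count-mono λ v → R⊆R′ zero (suc v) (s≤s z≤n))
           (pairCount-mono λ u v u<v → R⊆R′ (suc u) (suc v) (s≤s u<v))

pairCount-cong : ∀ {n} {R R′ : Fin n → Fin n → Bool} →
  (∀ u v → toℕ u < toℕ v → R u v ≡ R′ u v) → pairCount R ≡ pairCount R′
pairCount-cong R≗R′ = ≤-antisym (pairCount-mono λ u v u<v eq → trans (sym (R≗R′ u v u<v)) eq)
                                (pairCount-mono λ u v u<v eq → trans (R≗R′ u v u<v) eq)

pairCount-split : ∀ {n} (R Q : Fin n → Fin n → Bool) →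
  pairCount R ≡ pairCount (λ u v → R u v ∧ Q u v) + pairCount (λ u v → R u v ∧ not (Q u v))
pairCount-split {zero}  R Q = refl
pairCount-split {suc n} R Q = begin
  count (R zero ∘ suc) + pairCount R′
    ≡⟨ cong₂ _+_ (count-split (R zero ∘ suc) (Q zero ∘ suc)) (pairCount-split R′ Q′) ⟩
  (a + b) + (c + d) ≡⟨ +-exchange a b c d ⟩
  (a + c) + (b + d) ∎
  where
  open ≡-Reasoning
  R′ Q′ : Fin n → Fin n → Bool
  R′ u v = R (suc u) (suc v)
  Q′ u v = Q (suc u) (suc v)
  a b c d : ℕ
  a = count (λ v → R zero (suc v) ∧ Q zero (suc v))
  b = count (λ v → R zero (suc v) ∧ not (Q zero (suc v)))
  c = pairCount (λ u v → R′ u v ∧ Q′ u v)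
  d = pairCount (λ u v → R′ u v ∧ not (Q′ u v))
  +-exchange : ∀ a b c d → (a + b) + (c + d) ≡ (a + c) + (b + d)
  +-exchange = solve-∀

pairCount≡0⇒false : ∀ {n} (R : Fin n → Fin n → Bool) → pairCount R ≡ 0 →
  ∀ u v → toℕ u < toℕ v → R u v ≡ false
pairCount≡0⇒false {suc n} R eq zero    (suc v) _         =
  count≡0⇒false (R zero ∘ suc) (m+n≡0⇒m≡0 _ eq) v
pairCount≡0⇒false {suc n} R eq (suc u) (suc v) (s≤s u<v) =
  pairCount≡0⇒false (λ u v → R (suc u) (suc v)) (m+n≡0⇒n≡0 _ eq) u v u<v

pairCount-≤⇒⊇ : ∀ {n} {R R′ : Fin n → Fin n → Bool} → R ⊆< R′ → pairCount R′ ≤ pairCount R →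
  R′ ⊆< R
pairCount-≤⇒⊇ {R = R} {R′} R⊆R′ R′≤R u v u<v R′uv with R u v in Ruv
... | true  = refl
... | false = contradiction (trans (sym (pairCount≡0⇒false R′∖R R′∖R≡0 u v u<v))
                                 (cong₂ (λ x y → x ∧ not y) R′uv Ruv)) λ ()
  where
  R′∖R : Fin _ → Fin _ → Bool
  R′∖R u v = R′ u v ∧ not (R u v)
  R′∧R≡R : ∀ u v → toℕ u < toℕ v → R′ u v ∧ R u v ≡ R u v
  R′∧R≡R u v u<v with R u v in eq
  ... | true  = cong (_∧ true) (R⊆R′ u v u<v eq)
  ... | false = ∧-zeroʳ (R′ u v)
  R′∖R≡0 : pairCount R′∖R ≡ 0
  R′∖R≡0 = n≤0⇒n≡0 (+-cancelˡ-≤ (pairCount R) _ 0 (begin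
    pairCount R + pairCount R′∖R
      ≡⟨ cong (_+ pairCount R′∖R) (sym (pairCount-cong R′∧R≡R)) ⟩
    pairCount (λ u v → R′ u v ∧ R u v) + pairCount R′∖R ≡⟨ sym (pairCount-split R′ R) ⟩
    pairCount R′                                        ≤⟨ R′≤R ⟩
    pairCount R                                         ≡⟨ sym (+-identityʳ _) ⟩
    pairCount R + 0                                     ∎))
    where open ≤-Reasoning

C₂-suc : ∀ m → suc m C 2 ≡ m + m C 2
C₂-suc m = trans (sym (nCk+nC[k+1]≡[n+1]C[k+1] m 1)) (cong (_+ m C 2) (nC1≡n m))

C₂-+ : ∀ a b → (a + b) C 2 ≡ a C 2 + b C 2 + a * b
C₂-+ zero    b = sym (+-identityʳ (b C 2))
C₂-+ (suc a) b = begin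
  suc (a + b) C 2                   ≡⟨ C₂-suc (a + b) ⟩
  (a + b) + (a + b) C 2             ≡⟨ cong ((a + b) +_) (C₂-+ a b) ⟩
  (a + b) + (a C 2 + b C 2 + a * b) ≡⟨ regroup a b (a C 2) (b C 2) ⟩
  (a + a C 2) + b C 2 + suc a * b   ≡⟨ cong (λ x → x + b C 2 + suc a * b) (sym (C₂-suc a)) ⟩
  suc a C 2 + b C 2 + suc a * b     ∎
  where
  open ≡-Reasoning
  regroup : ∀ a b x y → (a + b) + (x + y + a * b) ≡ (a + x) + y + suc a * b
  regroup = solve-∀

pairCount-square : ∀ {n} (p : Fin n → Bool) → pairCount (λ u v → p u ∧ p v) ≡ count p C 2
pairCount-square {zero}  p = refl
pairCount-square {suc n} p with p zero
... | true  = trans (cong (count (p ∘ suc) +_) (pairCount-square (p ∘ suc)))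
                    (sym (C₂-suc (count (p ∘ suc))))
... | false = cong₂ _+_ (count-false n) (pairCount-square (p ∘ suc))

-- Non-edges and spanning subgraphs

nonEdges : ∀ {n} → Graph n → ℕ
nonEdges G = pairCount (λ u v → not (adj G u v))

tailGraph : ∀ {n} → Graph (suc n) → Graph n
tailGraph G = record
  { adj    = λ u v → adj G (suc u) (suc v)
  ; sym    = λ u v → Graph.sym G (suc u) (suc v)
  ; irrefl = λ v → irrefl G (suc v)
  }

edges≡pairCount : ∀ {n} (G : Graph n) → edges G ≡ pairCount (adj G)
edges≡pairCount {zero}  G = refl
edges≡pairCount {suc n} G = cong (count (adj G zero ∘ suc) +_) (edges≡pairCount (tailGraph G))

edges+nonEdges : ∀ {n} (G : Graph n) → edges G + nonEdges G ≡ n C 2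
edges+nonEdges {n} G = begin
  edges G + nonEdges G           ≡⟨ cong (_+ nonEdges G) (edges≡pairCount G) ⟩
  pairCount (adj G) + nonEdges G ≡⟨ sym (pairCount-split (λ _ _ → true) (adj G)) ⟩
  pairCount {n} (λ _ _ → true)   ≡⟨ pairCount-square {n} (λ _ → true) ⟩
  count {n} (λ _ → true) C 2     ≡⟨ cong (_C 2) (count-true n) ⟩
  n C 2                          ∎
  where open ≡-Reasoning

nonEdges-antitone : ∀ {n} (G H : Graph n) → edges H ≤ edges G → nonEdges G ≤ nonEdges H
nonEdges-antitone G H eH≤eG = +-cancelˡ-≤ (edges H) _ _ (begin
  edges H + nonEdges G ≤⟨ +-monoˡ-≤ (nonEdges G) eH≤eG ⟩
  edges G + nonEdges G ≡⟨ edges+nonEdges G ⟩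
  _                    ≡⟨ sym (edges+nonEdges H) ⟩
  edges H + nonEdges H ∎)
  where open ≤-Reasoning

infix 4 _≈ᴳ_

_≈ᴳ_ : ∀ {n} → Graph n → Graph n → Set
G ≈ᴳ H = ∀ u v → adj G u v ≡ adj H u v

nonEdges-cong : ∀ {n} (G H : Graph n) → G ≈ᴳ H → nonEdges G ≡ nonEdges H
nonEdges-cong _ _ G≈H = pairCount-cong λ u v _ → cong not (G≈H u v)

≈ᴳ-from-< : ∀ {n} {G H : Graph n} → (∀ u v → toℕ u < toℕ v → adj G u v ≡ adj H u v) → G ≈ᴳ H
≈ᴳ-from-< {G = G} {H} G≈H u v with <-cmp (toℕ u) (toℕ v)
... | tri< u<v _ _ = G≈H u v u<v
... | tri≈ _ u≡v _ rewrite toℕ-injective u≡v = trans (irrefl G v) (sym (irrefl H v))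
... | tri> _ _ v<u = trans (Graph.sym G u v) (trans (G≈H v u v<u) (Graph.sym H v u))

SpanningSubgraph : ∀ {n} → Graph n → Graph n → Set
SpanningSubgraph G H = ∀ u v → adj G u v ≡ true → adj H u v ≡ true

nonEdges-subgraph : ∀ {n} (G H : Graph n) → SpanningSubgraph G H → nonEdges H ≤ nonEdges G
nonEdges-subgraph G H G⊆H = pairCount-mono λ u v _ → not-antitone (G⊆H u v)

subgraph-rigid : ∀ {n} (G H : Graph n) → SpanningSubgraph G H → nonEdges G ≤ nonEdges H → G ≈ᴳ H
subgraph-rigid G H G⊆H G≤H = ≈ᴳ-from-< {G = G} {H} λ u v u<v → not-injective (agree u v u<v)
  where
  agree : ∀ u v → toℕ u < toℕ v → not (adj G u v) ≡ not (adj H u v)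
  agree u v u<v with adj G u v in eq
  ... | true  = sym (cong not (G⊆H u v eq))
  ... | false = sym (pairCount-≤⇒⊇ (λ u v _ → not-antitone (G⊆H u v)) G≤H u v u<v (cong not eq))

-- Joins

eqB-≢ : ∀ {n} {u v : Fin n} → u ≢ v → eqB u v ≡ false
eqB-≢ {u = u} {v} u≢v with u ≟ v
... | yes u≡v = contradiction u≡v u≢v
... | no  _   = refl

eqB-refl : ∀ {n} (u : Fin n) → eqB u u ≡ true
eqB-refl u with u ≟ u
... | yes _   = refl
... | no  u≢u = contradiction refl u≢u

eqB-< : ∀ {n} {u v : Fin n} → toℕ u < toℕ v → eqB u v ≡ false
eqB-< u<v = eqB-≢ λ { refl → <-irrefl refl u<v }

joinNonEdges : ℕ → ℕ → ℕ
joinNonEdges s r = s C 2 + s * r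

forced : ∀ {n} → (Fin n → Bool) → (Fin n → Bool) → Fin n → Fin n → Bool
forced S I u v = (not (S u) ∧ not (S v)) ∧ (I u ∨ I v)

rest : ∀ {n} → (Fin n → Bool) → (Fin n → Bool) → Fin n → Bool
rest S I v = not (S v) ∧ not (I v)

-- joinGraph S I is K_|S| ∨ (K_r + \overline{K_|I|}) with clique S, independent set I and the
-- r = count (rest S I) remaining vertices as K_r; forced S I are its non-edges.
joinGraph : ∀ {n} → (Fin n → Bool) → (Fin n → Bool) → Graph n
joinGraph S I = mkGraph (λ u v → not (forced S I u v)) forced-sym
  where
  forced-sym : ∀ u v → not (forced S I u v) ≡ not (forced S I v u)
  forced-sym u v = cong not (cong₂ _∧_ (∧-comm (not (S u)) (not (S v))) (∨-comm (I u) (I v)))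

pairCount-forced : ∀ {n} {S I : Fin n → Bool} → I ⊆ᵇ not ∘ S →
  pairCount (forced S I) ≡ joinNonEdges (count I) (count (rest S I))
pairCount-forced {S = S} {I} I⊆∁S = +-cancelʳ-≡ (r C 2) _ _ (begin
  pairCount (forced S I) + r C 2
    ≡⟨ cong (pairCount (forced S I) +_) (sym (pairCount-square (rest S I))) ⟩
  pairCount (forced S I) + pairCount (λ u v → rest S I u ∧ rest S I v)
    ≡⟨ cong (pairCount (forced S I) +_)
            (pairCount-cong λ u v _ → sym (∧-¬∨ (not (S u)) (not (S v)) (I u) (I v))) ⟩
  pairCount (forced S I) + pairCount (λ u v → (not (S u) ∧ not (S v)) ∧ not (I u ∨ I v))
    ≡⟨ sym (pairCount-split (λ u v → not (S u) ∧ not (S v)) (λ u v → I u ∨ I v)) ⟩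
  pairCount (λ u v → not (S u) ∧ not (S v))
    ≡⟨ pairCount-square (not ∘ S) ⟩
  count (not ∘ S) C 2
    ≡⟨ cong (_C 2) (count-⊆ I⊆∁S) ⟩
  (s + r) C 2
    ≡⟨ C₂-+ s r ⟩
  s C 2 + r C 2 + s * r
    ≡⟨ +-right-comm (s C 2) (r C 2) (s * r) ⟩
  joinNonEdges s r + r C 2 ∎)
  where
  open ≡-Reasoning
  s r : ℕ
  s = count I
  r = count (rest S I)
  ∧-¬∨ : ∀ a b c d → (a ∧ b) ∧ not (c ∨ d) ≡ (a ∧ not c) ∧ (b ∧ not d)
  ∧-¬∨ false b     c     d = refl
  ∧-¬∨ true  false true  d = refl
  ∧-¬∨ true  false false d = refl
  ∧-¬∨ true  true  true  d = refl
  ∧-¬∨ true  true  false d = refl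
  +-right-comm : ∀ a b c → a + b + c ≡ a + c + b
  +-right-comm = solve-∀

nonEdges-joinGraph : ∀ {n} {S I : Fin n → Bool} → I ⊆ᵇ not ∘ S →
  nonEdges (joinGraph S I) ≡ joinNonEdges (count I) (count (rest S I))
nonEdges-joinGraph {S = S} {I} I⊆∁S = trans (pairCount-cong non-adjacent) (pairCount-forced I⊆∁S)
  where
  non-adjacent : ∀ u v → toℕ u < toℕ v → not (adj (joinGraph S I) u v) ≡ forced S I u v
  non-adjacent u v u<v rewrite eqB-< u<v = not-involutive (forced S I u v)

Kjoin≈joinGraph : ∀ n d → Kjoin n d ≈ᴳ joinGraph (below d) (not ∘ below (n ∸ d))
Kjoin≈joinGraph n d u v =
  cong (not (eqB u v) ∧_) (identity (below d u) (below d v) (below (n ∸ d) u) (below (n ∸ d) v))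
  where
  identity : ∀ a b c d →
    (a ∨ b) ∨ ((not a ∧ c) ∧ (not b ∧ d)) ≡ not ((not a ∧ not b) ∧ (not c ∨ not d))
  identity true  b     c     d     = refl
  identity false true  c     d     = refl
  identity false false true  true  = refl
  identity false false true  false = refl
  identity false false false d     = refl

nonEdges-Kjoin : ∀ {n} d r → d + (d + r) ≡ n → nonEdges (Kjoin n d) ≡ joinNonEdges d r
nonEdges-Kjoin d r refl = begin
  nonEdges (Kjoin n d)
    ≡⟨ nonEdges-cong (Kjoin n d) (joinGraph S₀ I₀) (Kjoin≈joinGraph n d) ⟩
  nonEdges (joinGraph S₀ I₀)                   ≡⟨ nonEdges-joinGraph I₀⊆∁S₀ ⟩
  joinNonEdges (count I₀) (count (rest S₀ I₀)) ≡⟨ cong₂ joinNonEdges |I₀|≡d |rest|≡r ⟩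
  joinNonEdges d r                             ∎
  where
  open ≡-Reasoning
  n : ℕ
  n = d + (d + r)
  S₀ C₀ I₀ : Fin n → Bool
  S₀ = below d
  C₀ = below (n ∸ d)
  I₀ = not ∘ C₀
  n∸d≡d+r : n ∸ d ≡ d + r
  n∸d≡d+r = m+n∸m≡n d (d + r)
  I₀⊆∁S₀ : I₀ ⊆ᵇ not ∘ S₀
  I₀⊆∁S₀ v eq = cong not (≥⇒<ᵇ≡false (≤-trans (m≤m+n d r)
    (subst (_≤ toℕ v) n∸d≡d+r (<ᵇ≡false⇒≥ _ _ (not-injective eq)))))
  |I₀|≡d : count I₀ ≡ d
  |I₀|≡d = +-cancelˡ-≡ (n ∸ d) _ _ (begin
    n ∸ d + count I₀    ≡⟨ cong (_+ count I₀) (sym (count-below (n ∸ d) (m∸n≤m n d))) ⟩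
    count C₀ + count I₀ ≡⟨ count-+-count-not C₀ ⟩
    n                   ≡⟨ +-comm d (d + r) ⟩
    (d + r) + d         ≡⟨ cong (_+ d) (sym n∸d≡d+r) ⟩
    n ∸ d + d           ∎)
  |rest|≡r : count (rest S₀ I₀) ≡ r
  |rest|≡r = +-cancelˡ-≡ d _ _ (+-cancelˡ-≡ d _ _ (begin
    d + (d + count (rest S₀ I₀))
      ≡⟨ cong₂ (λ x y → x + (y + count (rest S₀ I₀)))
               (sym (count-below {n} d (m≤m+n d (d + r)))) (sym |I₀|≡d) ⟩
    count S₀ + (count I₀ + count (rest S₀ I₀)) ≡⟨ cong (count S₀ +_) (sym (count-⊆ I₀⊆∁S₀)) ⟩
    count S₀ + count (not ∘ S₀)                ≡⟨ count-+-count-not S₀ ⟩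
    n                                          ∎))

half-double : ∀ t → (t + t) / 2 ≡ t
half-double t = trans (cong (_/ 2) (+-double t)) (m*n/n≡m t 2)
  where
  +-double : ∀ t → t + t ≡ t * 2
  +-double = solve-∀

-- For n = 2t + 1 the K_{n−2t} part of Kjoin n t is the single vertex t, so it adds no edge.
Ksplit≈Kjoin : ∀ t → Ksplit (suc (t + t)) ≈ᴳ Kjoin (suc (t + t)) t
Ksplit≈Kjoin t u v rewrite half-double t with u ≟ v
... | yes refl = refl
... | no  u≢v  =
  cong (true ∧_) (sym (trans (cong ((below t u ∨ below t v) ∨_) middle-unique) (∨-identityʳ _)))
  where
  middle : Fin (suc (t + t)) → Bool
  middle w = not (below t w) ∧ below (suc (t + t) ∸ t) w
  n∸t≡suc-t : suc (t + t) ∸ t ≡ suc t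
  n∸t≡suc-t = trans (+-∸-assoc 1 (m≤m+n t t)) (cong suc (m+n∸m≡n t t))
  middle⇒≡t : ∀ w → middle w ≡ true → toℕ w ≡ t
  middle⇒≡t w eq with below t w in w≮t
  ... | false = ≤-antisym (s≤s⁻¹ (subst (toℕ w <_) n∸t≡suc-t (<ᵇ≡true⇒< _ _ eq))) (<ᵇ≡false⇒≥ _ _ w≮t)
  middle-unique : middle u ∧ middle v ≡ false
  middle-unique with middle u in mu | middle v in mv
  ... | false | _     = refl
  ... | true  | false = refl
  ... | true  | true  =
    contradiction (toℕ-injective (trans (middle⇒≡t u mu) (sym (middle⇒≡t v mv)))) u≢v

t+[t+1]≡1+2t : ∀ t → t + (t + 1) ≡ suc (t + t)
t+[t+1]≡1+2t t = trans (cong (t +_) (+-comm t 1)) (+-suc t t)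

nonEdges-Ksplit : ∀ {n} t → suc (t + t) ≡ n → nonEdges (Ksplit n) ≡ joinNonEdges t 1
nonEdges-Ksplit t refl =
  trans (nonEdges-cong (Ksplit (suc (t + t))) (Kjoin (suc (t + t)) t) (Ksplit≈Kjoin t))
        (nonEdges-Kjoin t 1 (t+[t+1]≡1+2t t))

Kjoin-half⇒Ksplit : ∀ {n} t {G : Graph n} → n ≡ t + (t + 1) → Iso G (Kjoin n t) → Iso G (Ksplit n)
Kjoin-half⇒Ksplit t n≡ (f , G≅K) with trans n≡ (t+[t+1]≡1+2t t)
... | refl = f , λ u v → trans (G≅K u v) (sym (Ksplit≈Kjoin t _ _))

-- Relabelling a join

toℕ-punchIn-fromℕ : ∀ {m} (x : Fin m) → toℕ (punchIn (fromℕ m) x) ≡ toℕ x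
toℕ-punchIn-fromℕ zero    = refl
toℕ-punchIn-fromℕ (suc x) = cong suc (toℕ-punchIn-fromℕ x)

punchIn-<ᵇ : ∀ {m} (j : Fin (suc m)) (x : Fin m) {c} → toℕ j ≡ c →
  (toℕ (punchIn j x) <ᵇ c) ≡ (toℕ x <ᵇ c)
punchIn-<ᵇ zero    x       refl = refl
punchIn-<ᵇ (suc j) zero    refl = refl
punchIn-<ᵇ (suc j) (suc x) refl = punchIn-<ᵇ j x refl

punchIn-<ᵇ-suc : ∀ {m} (j : Fin (suc m)) (x : Fin m) {t} → toℕ j ≤ t →
  (toℕ (punchIn j x) <ᵇ suc t) ≡ (toℕ x <ᵇ t)
punchIn-<ᵇ-suc zero    x       _         = refl
punchIn-<ᵇ-suc (suc j) zero    (s≤s _)   = refl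
punchIn-<ᵇ-suc (suc j) (suc x) (s≤s j≤t) = punchIn-<ᵇ-suc j x j≤t

Sorts : ∀ {n} → (Fin n → Bool) → (Fin n → Bool) → Permutation n n → Set
Sorts {n} S I π = ∀ v →
  S v ≡ below (count S) (π ⟨$⟩ʳ v) × I v ≡ not (below (n ∸ count I) (π ⟨$⟩ʳ v))

countFin : ∀ {m} → (Fin m → Bool) → Fin (suc m)
countFin p = fromℕ< (s≤s (count-≤ p))

module _ {m} {S I : Fin (suc m) → Bool} (I⊆∁S : I ⊆ᵇ not ∘ S)
         {π′ : Permutation m m} (sorts′ : Sorts (S ∘ suc) (I ∘ suc) π′) where

  private
    |S′| |I′| : ℕ
    |S′| = count (S ∘ suc)
    |I′| = count (I ∘ suc)
    suc-m∸|I′| : suc m ∸ |I′| ≡ suc (m ∸ |I′|)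
    suc-m∸|I′| = +-∸-assoc 1 (count-≤ (I ∘ suc))
    j : Fin (suc m)
    j = countFin (S ∘ suc)
    toℕj : toℕ j ≡ |S′|
    toℕj = toℕ-fromℕ< (s≤s (count-≤ (S ∘ suc)))
    |S′|≤m∸|I′| : |S′| ≤ m ∸ |I′|
    |S′|≤m∸|I′| = subst (_≤ m ∸ |I′|) (m+n∸n≡m |S′| |I′|)
                        (∸-monoˡ-≤ |I′| (count-disjoint (I⊆∁S ∘ suc)))

  sorts-front : S zero ≡ true → I zero ≡ false → Sorts S I (insert zero zero π′)
  sorts-front eS eI zero    rewrite eS | eI | suc-m∸|I′| = refl , refl
  sorts-front eS eI (suc k) rewrite eS | eI | insert-punchIn zero zero π′ k | suc-m∸|I′| = sorts′ k

  sorts-back : S zero ≡ false → I zero ≡ true → Sorts S I (insert zero (fromℕ m) π′)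
  sorts-back eS eI zero rewrite eS | eI | toℕ-fromℕ m =
    sym (≥⇒<ᵇ≡false (count-≤ (S ∘ suc))) , sym (cong not (≥⇒<ᵇ≡false (m∸n≤m m |I′|)))
  sorts-back eS eI (suc k) rewrite eS | eI | insert-punchIn zero (fromℕ m) π′ k
                                 | toℕ-punchIn-fromℕ (π′ ⟨$⟩ʳ k) = sorts′ k

  sorts-between : S zero ≡ false → I zero ≡ false → Sorts S I (insert zero j π′)
  sorts-between eS eI zero rewrite eS | eI | toℕj | suc-m∸|I′| =
    sym (≥⇒<ᵇ≡false (≤-refl {|S′|})) , sym (cong not (<⇒<ᵇ≡true (s≤s |S′|≤m∸|I′|)))
  sorts-between eS eI (suc k) rewrite eS | eI | insert-punchIn zero j π′ k | suc-m∸|I′| =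
    trans (proj₁ (sorts′ k)) (sym (punchIn-<ᵇ j x toℕj)) ,
    trans (proj₂ (sorts′ k)) (cong not (sym (punchIn-<ᵇ-suc j x j≤m∸|I′|)))
    where
    x : Fin m
    x = π′ ⟨$⟩ʳ k
    j≤m∸|I′| : toℕ j ≤ m ∸ |I′|
    j≤m∸|I′| = subst (_≤ m ∸ |I′|) (sym toℕj) |S′|≤m∸|I′|

sorting : ∀ {n} (S I : Fin n → Bool) → I ⊆ᵇ not ∘ S → Σ (Permutation n n) (Sorts S I)
sorting {zero}  S I _    = Permutation.id , λ ()
sorting {suc m} S I I⊆∁S =
  extend (sorting (S ∘ suc) (I ∘ suc) (I⊆∁S ∘ suc)) (S zero) (I zero) refl refl
  where
  extend : Σ (Permutation m m) (Sorts (S ∘ suc) (I ∘ suc)) →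
           ∀ x y → S zero ≡ x → I zero ≡ y → Σ (Permutation (suc m) (suc m)) (Sorts S I)
  extend _             true  true  eS eI = contradiction (trans (sym (I⊆∁S zero eI)) (cong not eS)) λ ()
  extend (π′ , sorts′) true  false eS eI = insert zero zero π′ , sorts-front I⊆∁S sorts′ eS eI
  extend (π′ , sorts′) false true  eS eI = insert zero (fromℕ m) π′ , sorts-back I⊆∁S sorts′ eS eI
  extend (π′ , sorts′) false false eS eI =
    insert zero (countFin (S ∘ suc)) π′ , sorts-between I⊆∁S sorts′ eS eI

eqB-perm : ∀ {n} (π : Permutation n n) u v → eqB (π ⟨$⟩ʳ u) (π ⟨$⟩ʳ v) ≡ eqB u v
eqB-perm π u v with u ≟ v
... | yes refl = eqB-refl (π ⟨$⟩ʳ u)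
... | no  u≢v  =
  eqB-≢ λ πu≡πv → u≢v (trans (sym (inverseˡ π)) (trans (cong (π ⟨$⟩ˡ_) πu≡πv) (inverseˡ π)))

joinGraph-transport : ∀ {n} {S I S′ I′ : Fin n → Bool} (π : Permutation n n) →
  (∀ v → S v ≡ S′ (π ⟨$⟩ʳ v)) → (∀ v → I v ≡ I′ (π ⟨$⟩ʳ v)) →
  ∀ u v → adj (joinGraph S I) u v ≡ adj (joinGraph S′ I′) (π ⟨$⟩ʳ u) (π ⟨$⟩ʳ v)
joinGraph-transport π Sπ Iπ u v rewrite eqB-perm π u v | Sπ u | Sπ v | Iπ u | Iπ v = refl

joinGraph≅Kjoin : ∀ {n d} {S I : Fin n → Bool} → I ⊆ᵇ not ∘ S → count S ≡ d → count I ≡ d →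
  Iso (joinGraph S I) (Kjoin n d)
joinGraph≅Kjoin {n} {S = S} {I} I⊆∁S refl |I|≡|S| with sorting S I I⊆∁S
... | π , sorts = π , λ u v →
  trans (joinGraph-transport {S′ = S₀} {I₀} π (proj₁ ∘ sorts) Iπ u v)
        (sym (Kjoin≈joinGraph n (count S) (π ⟨$⟩ʳ u) (π ⟨$⟩ʳ v)))
  where
  S₀ I₀ : Fin n → Bool
  S₀ = below (count S)
  I₀ = not ∘ below (n ∸ count S)
  Iπ : ∀ v → I v ≡ I₀ (π ⟨$⟩ʳ v)
  Iπ v = trans (proj₂ (sorts v)) (cong (λ k → not (below (n ∸ k) (π ⟨$⟩ʳ v))) |I|≡|S|)

twice-C₂ : ∀ m → 2 * (m C 2) + m ≡ m * m
twice-C₂ zero    = refl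
twice-C₂ (suc m) = begin
  2 * (suc m C 2) + suc m         ≡⟨ cong (λ x → 2 * x + suc m) (C₂-suc m) ⟩
  2 * (m + m C 2) + suc m         ≡⟨ regroup m (m C 2) ⟩
  (2 * (m C 2) + m) + (m + suc m) ≡⟨ cong (_+ (m + suc m)) (twice-C₂ m) ⟩
  m * m + (m + suc m)             ≡⟨ square-suc m ⟩
  suc m * suc m                   ∎
  where
  open ≡-Reasoning
  regroup : ∀ m x → 2 * (m + x) + suc m ≡ (2 * x + m) + (m + suc m)
  regroup = solve-∀
  square-suc : ∀ m → m * m + (m + suc m) ≡ suc m * suc m
  square-suc = solve-∀

twice-joinNonEdges : ∀ s r → 2 * joinNonEdges s r + s ≡ s * s + 2 * s * r
twice-joinNonEdges s r = begin
  2 * (s C 2 + s * r) + s       ≡⟨ regroup (s C 2) s r ⟩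
  (2 * (s C 2) + s) + 2 * s * r ≡⟨ cong (_+ 2 * s * r) (twice-C₂ s) ⟩
  s * s + 2 * s * r             ∎
  where
  open ≡-Reasoning
  regroup : ∀ x s r → 2 * (x + s * r) + s ≡ (2 * x + s) + 2 * s * r
  regroup = solve-∀

-- With n fixed, s ↦ joinNonEdges s (n − 2s) is concave. The two gap lemmas compare its value
-- at s = a + d with the left end d, and at s with the right end b + s = (n − 1)/2.
joinNonEdges-gap-left : ∀ d a b c → c + 2 * d ≤ suc (a + b) →
  2 * joinNonEdges d (2 * a + suc (2 * b)) + a * (c + 3 * b) ≤ 2 * joinNonEdges (a + d) (suc (2 * b))
joinNonEdges-gap-left d a b c c+2d≤a+b+1 = +-cancelʳ-≤ (a + d) _ _ (begin
  2 * joinNonEdges d r′ + a * (c + 3 * b) + (a + d)   ≡⟨ regroup (joinNonEdges d r′) d a b c ⟩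
  (2 * joinNonEdges d r′ + d) + (a * (c + 3 * b) + a)
    ≡⟨ cong (_+ (a * (c + 3 * b) + a)) (twice-joinNonEdges d r′) ⟩
  d * d + 2 * d * r′ + (a * (c + 3 * b) + a)          ≡⟨ expand₁ d a b c ⟩
  P + a * (c + 2 * d)                                 ≤⟨ +-monoʳ-≤ P (*-monoʳ-≤ a c+2d≤a+b+1) ⟩
  P + a * suc (a + b)                                 ≡⟨ expand₂ d a b ⟩
  (a + d) * (a + d) + 2 * (a + d) * r                 ≡⟨ sym (twice-joinNonEdges (a + d) r) ⟩
  2 * joinNonEdges (a + d) r + (a + d)                ∎)
  where
  open ≤-Reasoning
  r r′ P : ℕ
  r  = suc (2 * b)
  r′ = 2 * a + r
  P  = d * d + 2 * d * a + 2 * d + 4 * d * b + 3 * a * b + a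
  regroup : ∀ x d a b c → 2 * x + a * (c + 3 * b) + (a + d) ≡ (2 * x + d) + (a * (c + 3 * b) + a)
  regroup = solve-∀
  expand₁ : ∀ d a b c → d * d + 2 * d * (2 * a + suc (2 * b)) + (a * (c + 3 * b) + a)
                      ≡ (d * d + 2 * d * a + 2 * d + 4 * d * b + 3 * a * b + a) + a * (c + 2 * d)
  expand₁ = solve-∀
  expand₂ : ∀ d a b → (d * d + 2 * d * a + 2 * d + 4 * d * b + 3 * a * b + a) + a * suc (a + b)
                    ≡ (a + d) * (a + d) + 2 * (a + d) * suc (2 * b)
  expand₂ = solve-∀

joinNonEdges-gap-right : ∀ s b → suc (suc b) ≤ 2 * s →
  2 * joinNonEdges (b + s) 1 + b ≤ 2 * joinNonEdges s (suc (2 * b))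
joinNonEdges-gap-right s b b+2≤2s = +-cancelʳ-≤ (b + s) _ _ (begin
  2 * joinNonEdges (b + s) 1 + b + (b + s)   ≡⟨ regroup (joinNonEdges (b + s) 1) s b ⟩
  (2 * joinNonEdges (b + s) 1 + (b + s)) + b ≡⟨ cong (_+ b) (twice-joinNonEdges (b + s) 1) ⟩
  (b + s) * (b + s) + 2 * (b + s) * 1 + b    ≡⟨ expand₁ s b ⟩
  Q + b * suc (suc b)                        ≤⟨ +-monoʳ-≤ Q (*-monoʳ-≤ b b+2≤2s) ⟩
  Q + b * (2 * s)                            ≡⟨ expand₂ s b ⟩
  s * s + 2 * s * r + b                      ≡⟨ cong (_+ b) (sym (twice-joinNonEdges s r)) ⟩
  2 * joinNonEdges s r + s + b               ≡⟨ regroup′ (joinNonEdges s r) s b ⟩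
  2 * joinNonEdges s r + (b + s)             ∎)
  where
  open ≤-Reasoning
  r Q : ℕ
  r = suc (2 * b)
  Q = s * s + 2 * s * b + 2 * s + b
  regroup : ∀ x s b → 2 * x + b + (b + s) ≡ (2 * x + (b + s)) + b
  regroup = solve-∀
  expand₁ : ∀ s b → (b + s) * (b + s) + 2 * (b + s) * 1 + b
                  ≡ (s * s + 2 * s * b + 2 * s + b) + b * suc (suc b)
  expand₁ = solve-∀
  expand₂ : ∀ s b → (s * s + 2 * s * b + 2 * s + b) + b * (2 * s) ≡ s * s + 2 * s * suc (2 * b) + b
  expand₂ = solve-∀
  regroup′ : ∀ x s b → 2 * x + s + b ≡ 2 * x + (b + s)
  regroup′ = solve-∀

squeeze : ∀ {lo x hi e} → lo ≤ x → x ≤ hi → 2 * hi + e ≤ 2 * lo → e ≡ 0 × x ≡ lo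
squeeze {lo} {x} {hi} {e} lo≤x x≤hi 2hi+e≤2lo = e≡0 , ≤-antisym (≤-trans x≤hi hi≤lo) lo≤x
  where
  hi≤lo : hi ≤ lo
  hi≤lo = *-cancelˡ-≤ 2 (≤-trans (m≤m+n (2 * hi) e) 2hi+e≤2lo)
  e≡0 : e ≡ 0
  e≡0 = n≤0⇒n≡0 (+-cancelˡ-≤ (2 * hi) e 0 (begin
    2 * hi + e ≤⟨ 2hi+e≤2lo ⟩
    2 * lo     ≤⟨ *-monoʳ-≤ 2 (≤-trans lo≤x x≤hi) ⟩
    2 * hi     ≡⟨ sym (+-identityʳ (2 * hi)) ⟩
    2 * hi + 0 ∎))
    where open ≤-Reasoning

6d≤n⇒2d<a+b+1 : ∀ {n} d a b → n ≡ (a + d) + ((a + d) + suc (2 * b)) → 6 * d ≤ n →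
  2 * d < suc (a + b)
6d≤n⇒2d<a+b+1 d a b refl 6d≤n =
  *-cancelˡ-< 2 (2 * d) (suc (a + b)) (+-cancelˡ-≤ (2 * d) _ _ (begin
    2 * d + suc (2 * (2 * d))               ≡⟨ expand₁ d ⟩
    suc (6 * d)                             ≤⟨ s≤s 6d≤n ⟩
    suc ((a + d) + ((a + d) + suc (2 * b))) ≡⟨ expand₂ d a b ⟩
    2 * d + 2 * suc (a + b)                 ∎))
  where
  open ≤-Reasoning
  expand₁ : ∀ d → 2 * d + suc (2 * (2 * d)) ≡ suc (6 * d)
  expand₁ = solve-∀
  expand₂ : ∀ d a b → suc ((a + d) + ((a + d) + suc (2 * b))) ≡ 2 * d + 2 * suc (a + b)
  expand₂ = solve-∀

1+n≡6d⇒2d≡a+b+1 : ∀ {n} d a b → n ≡ (a + d) + ((a + d) + suc (2 * b)) → suc n ≡ 6 * d →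
  2 * d ≡ suc (a + b)
1+n≡6d⇒2d≡a+b+1 d a b refl 1+n≡6d =
  *-cancelˡ-≡ (2 * d) (suc (a + b)) 2 (sym (+-cancelˡ-≡ (2 * d) _ _ (begin
    2 * d + 2 * suc (a + b)                 ≡⟨ expand₁ d a b ⟩
    suc ((a + d) + ((a + d) + suc (2 * b))) ≡⟨ 1+n≡6d ⟩
    6 * d                                   ≡⟨ expand₂ d ⟩
    2 * d + 2 * (2 * d)                     ∎)))
  where
  open ≡-Reasoning
  expand₁ : ∀ d a b → 2 * d + 2 * suc (a + b) ≡ suc ((a + d) + ((a + d) + suc (2 * b)))
  expand₁ = solve-∀
  expand₂ : ∀ d → 6 * d ≡ 2 * d + 2 * (2 * d)
  expand₂ = solve-∀

n+2≤6d⇒b+1<2s : ∀ {n} d a b → n ≡ (a + d) + ((a + d) + suc (2 * b)) → suc (suc n) ≤ 6 * d →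
  suc b < 2 * (a + d)
n+2≤6d⇒b+1<2s d a b refl n+2≤6d = *-cancelˡ-< 2 (suc b) (2 * s) (+-cancelˡ-≤ (s + s) _ _ (begin
  (s + s) + suc (2 * suc b)         ≡⟨ expand₁ s b ⟩
  suc (suc (s + (s + suc (2 * b)))) ≤⟨ n+2≤6d ⟩
  6 * d                             ≤⟨ *-monoʳ-≤ 6 (m≤n+m d a) ⟩
  6 * s                             ≡⟨ expand₂ s ⟩
  (s + s) + 2 * (2 * s)             ∎))
  where
  open ≤-Reasoning
  s : ℕ
  s = a + d
  expand₁ : ∀ s b → (s + s) + suc (2 * suc b) ≡ suc (suc (s + (s + suc (2 * b))))
  expand₁ = solve-∀
  expand₂ : ∀ s → 6 * s ≡ (s + s) + 2 * (2 * s)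
  expand₂ = solve-∀

odd-part : ∀ s r → ¬ 2 ∣ s + (s + r) → ∃[ b ] r ≡ suc (2 * b)
odd-part s r n-odd with r % 2 | m%n<n r 2 | m≡m%n+[m/n]*n r 2
... | 0 | _ | r≡ =
  contradiction (divides (s + r / 2) (trans (cong (λ x → s + (s + x)) r≡) (regroup s (r / 2)))) n-odd
  where
  regroup : ∀ s q → s + (s + q * 2) ≡ (s + q) * 2
  regroup = solve-∀
... | 1 | _ | r≡ = r / 2 , trans r≡ (cong suc (*-comm (r / 2) 2))
... | suc (suc _) | s≤s (s≤s ()) | _

suc[6δ∸1]≡6δ : ∀ δ → 1 ≤ δ → suc (6 * δ ∸ 1) ≡ 6 * δ
suc[6δ∸1]≡6δ (suc δ) _ = refl

-- Sets S with i(G − S) ≥ |S| > 0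

isolatedIn : ∀ {n} → Graph n → Subset n → Fin n → Bool
isolatedIn G S v = not (inS S v) ∧ allF (λ u → inS S u ∨ not (adj G v u))

isolatedIn-nbr : ∀ {n} (G : Graph n) S {u v} → isolatedIn G S u ≡ true → adj G u v ≡ true →
  inS S v ≡ true
isolatedIn-nbr G S {u} {v} iso uv = trans (sym (∨-identityʳ (inS S v)))
  (subst (λ x → inS S v ∨ not x ≡ true) uv (allF≡true _ (proj₂ (∧≡true iso)) v))

isolatedIn-non-adj : ∀ {n} (G : Graph n) S {u v} → isolatedIn G S u ≡ true → not (inS S v) ≡ true →
  adj G u v ≡ false
isolatedIn-non-adj G S {u} {v} iso ∉v with adj G u v in uv
... | false = refl
... | true  = contradiction (trans (sym (cong not (isolatedIn-nbr G S iso uv))) ∉v) λ ()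

BadSet : ∀ {n} → Graph n → Subset n → Set
BadSet G S = 0 < card S × card S ≤ isolated G S

module _ {n} (G : Graph n) (S : Subset n) {I : Fin n → Bool} (I⊆iso : I ⊆ᵇ isolatedIn G S) where

  ⊆isolated⇒⊆∁S : I ⊆ᵇ not ∘ inS S
  ⊆isolated⇒⊆∁S v Iv = proj₁ (∧≡true (I⊆iso v Iv))

  forced⇒non-adjacent : ∀ {u v} → forced (inS S) I u v ≡ true → adj G u v ≡ false
  forced⇒non-adjacent {u} {v} f with ∧≡true {not (inS S u) ∧ not (inS S v)} f
  ... | ∉uv , Iu∨Iv with ∧≡true {not (inS S u)} ∉uv | ∨≡true {I u} Iu∨Iv
  ... | ∉u , ∉v | inj₁ Iu = isolatedIn-non-adj G S (I⊆iso u Iu) ∉v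
  ... | ∉u , ∉v | inj₂ Iv = trans (Graph.sym G u v) (isolatedIn-non-adj G S (I⊆iso v Iv) ∉u)

  subgraph-of-join : SpanningSubgraph G (joinGraph (inS S) I)
  subgraph-of-join u v uv with u ≟ v
  ... | yes refl = contradiction (trans (sym uv) (irrefl G u)) λ ()
  ... | no  _    with forced (inS S) I u v in f
  ...   | false = refl
  ...   | true  = contradiction (trans (sym uv) (forced⇒non-adjacent f)) λ ()

-- What a bad set S forces on G, with |S| = a + δ and n − 2|S| = 2b + 1.
record JoinShape {n} (G : Graph n) (δ : ℕ) : Set where
  constructor joinShape
  field
    a b   : ℕ
    order : n ≡ (a + δ) + ((a + δ) + suc (2 * b))
    lower : joinNonEdges (a + δ) (suc (2 * b)) ≤ nonEdges G
    rigid : nonEdges G ≤ joinNonEdges (a + δ) (suc (2 * b)) → Iso G (Kjoin n (a + δ))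

joinShape-intro : ∀ {n δ s r} {G : Graph n} → ¬ 2 ∣ n → δ ≤ s → n ≡ s + (s + r) →
  joinNonEdges s r ≤ nonEdges G → (nonEdges G ≤ joinNonEdges s r → Iso G (Kjoin n s)) → JoinShape G δ
joinShape-intro {δ = δ} {s} {r} n-odd δ≤s order lower rigid
  with s ∸ δ | m∸n+n≡m δ≤s | odd-part s r (subst (¬_ ∘ (2 ∣_)) order n-odd)
... | a | refl | b , refl = joinShape a b order lower rigid

badSet⇒joinShape : ∀ {n δ} {G : Graph n} (S : Subset n) → ¬ 2 ∣ n → MinDegreeAtLeast G δ →
  BadSet G S → JoinShape G δ
badSet⇒joinShape {n} {δ} {G} S n-odd δ≤deg (|S|>0 , |S|≤i) =
  joinShape-intro n-odd δ≤s order lower rigid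
  where
  s : ℕ
  s = card S
  chosen : ∃[ I ] I ⊆ᵇ isolatedIn G S × count I ≡ s
  chosen = shrink (isolatedIn G S) s |S|≤i
  I : Fin n → Bool
  I = proj₁ chosen
  I⊆iso : I ⊆ᵇ isolatedIn G S
  I⊆iso = proj₁ (proj₂ chosen)
  |I|≡s : count I ≡ s
  |I|≡s = proj₂ (proj₂ chosen)
  I⊆∁S : I ⊆ᵇ not ∘ inS S
  I⊆∁S = ⊆isolated⇒⊆∁S G S I⊆iso
  r : ℕ
  r = count (rest (inS S) I)
  order : n ≡ s + (s + r)
  order = sym (trans (cong (s +_) (sym (trans (count-⊆ I⊆∁S) (cong (_+ r) |I|≡s))))
                     (count-+-count-not (inS S)))
  nonEdges-join : nonEdges (joinGraph (inS S) I) ≡ joinNonEdges s r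
  nonEdges-join = trans (nonEdges-joinGraph I⊆∁S) (cong (λ k → joinNonEdges k r) |I|≡s)
  lower : joinNonEdges s r ≤ nonEdges G
  lower = subst (_≤ nonEdges G) nonEdges-join
                (nonEdges-subgraph G (joinGraph (inS S) I) (subgraph-of-join G S I⊆iso))
  rigid : nonEdges G ≤ joinNonEdges s r → Iso G (Kjoin n s)
  rigid le with joinGraph≅Kjoin I⊆∁S refl |I|≡s
  ... | f , J≅K = f , λ u v → trans (G≈J u v) (J≅K u v)
    where
    G≈J : G ≈ᴳ joinGraph (inS S) I
    G≈J = subgraph-rigid G (joinGraph (inS S) I) (subgraph-of-join G S I⊆iso)
                         (subst (nonEdges G ≤_) (sym nonEdges-join) le)
  δ≤s : δ ≤ s
  δ≤s with count>0⇒∃ I (subst (0 <_) (sym |I|≡s) |S|>0)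
  ... | v , Iv =
    ≤-trans (δ≤deg v) (count-mono {p = adj G v} {q = inS S} λ u → isolatedIn-nbr G S (I⊆iso v Iv))

module _ {n δ : ℕ} {G : Graph n} where

  nonEdges≤Kjoin : ∀ a b → n ≡ (a + δ) + ((a + δ) + suc (2 * b)) → edges (Kjoin n δ) ≤ edges G →
    nonEdges G ≤ joinNonEdges δ (2 * a + suc (2 * b))
  nonEdges≤Kjoin a b order eK≤eG = ≤-trans (nonEdges-antitone G (Kjoin n δ) eK≤eG)
    (≤-reflexive (nonEdges-Kjoin δ _ (trans (regroup a δ b) (sym order))))
    where
    regroup : ∀ a δ b → δ + (δ + (2 * a + suc (2 * b))) ≡ (a + δ) + ((a + δ) + suc (2 * b))
    regroup = solve-∀

  nonEdges≤Ksplit : ∀ a b → n ≡ (a + δ) + ((a + δ) + suc (2 * b)) → edges (Ksplit n) ≤ edges G →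
    nonEdges G ≤ joinNonEdges (b + (a + δ)) 1
  nonEdges≤Ksplit a b order eS≤eG = ≤-trans (nonEdges-antitone G (Ksplit n) eS≤eG)
    (≤-reflexive (nonEdges-Ksplit (b + (a + δ)) (trans (regroup a δ b) (sym order))))
    where
    regroup : ∀ a δ b → suc ((b + (a + δ)) + (b + (a + δ))) ≡ (a + δ) + ((a + δ) + suc (2 * b))
    regroup = solve-∀

  joinShape-6δ≤n : JoinShape G δ → 6 * δ ≤ n → edges (Kjoin n δ) ≤ edges G → Iso G (Kjoin n δ)
  joinShape-6δ≤n (joinShape a b order lower rigid) 6δ≤n eK≤eG
    with squeeze lower (nonEdges≤Kjoin a b order eK≤eG)
                 (joinNonEdges-gap-left δ a b 1 (6d≤n⇒2d<a+b+1 δ a b order 6δ≤n))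
  ... | a*[1+3b]≡0 , tight with m*n≡0⇒m≡0 a (1 + 3 * b) a*[1+3b]≡0
  ... | refl = rigid (≤-reflexive tight)

  joinShape-1+n≡6δ : JoinShape G δ → suc n ≡ 6 * δ → edges (Kjoin n δ) ≤ edges G →
    Iso G (Kjoin n δ) ⊎ Iso G (Ksplit n)
  joinShape-1+n≡6δ (joinShape a b order lower rigid) 1+n≡6δ eK≤eG
    with squeeze lower (nonEdges≤Kjoin a b order eK≤eG)
                 (joinNonEdges-gap-left δ a b 0 (≤-reflexive (1+n≡6d⇒2d≡a+b+1 δ a b order 1+n≡6δ)))
  ... | a*3b≡0 , tight with m*n≡0⇒m≡0∨n≡0 a a*3b≡0
  ... | inj₁ refl = inj₁ (rigid (≤-reflexive tight))
  ... | inj₂ 3b≡0 with m*n≡0⇒m≡0∨n≡0 3 {b} 3b≡0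
  ...   | inj₂ refl = inj₂ (Kjoin-half⇒Ksplit (a + δ) {G} order (rigid (≤-reflexive tight)))

  joinShape-n+2≤6δ : JoinShape G δ → suc (suc n) ≤ 6 * δ → edges (Ksplit n) ≤ edges G →
    Iso G (Ksplit n)
  joinShape-n+2≤6δ (joinShape a b order lower rigid) n+2≤6δ eS≤eG
    with squeeze lower (nonEdges≤Ksplit a b order eS≤eG)
                 (joinNonEdges-gap-right (a + δ) b (n+2≤6d⇒b+1<2s δ a b order n+2≤6δ))
  ... | refl , tight = Kjoin-half⇒Ksplit (a + δ) {G} order (rigid (≤-reflexive tight))

-- GFC for even k

oddB-even : ∀ {k} → 2 ∣ k → oddB k ≡ false
oddB-even {k} 2∣k rewrite n∣m⇒m%n≡0 k 2 2∣k = refl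

φ-even : ∀ {n k} (G : Graph n) S → 2 ∣ k → φ k G S ≡ ℤ.+ (k * isolated G S) ℤ.- ℤ.+ (k * card S)
φ-even G S 2∣k rewrite oddB-even 2∣k = refl

card≡0⇒≡∅ : ∀ {n} (S : Subset n) → card S ≡ 0 → S ≡ ∅
card≡0⇒≡∅ S |S|≡0 = begin
  S                   ≡⟨ sym (tabulate∘lookup S) ⟩
  tabulate (lookup S)
    ≡⟨ tabulate-cong (λ v → trans (count≡0⇒false (lookup S) |S|≡0 v) (sym (lookup-replicate v false))) ⟩
  tabulate (lookup ∅) ≡⟨ tabulate∘lookup ∅ ⟩
  ∅                   ∎
  where open ≡-Reasoning

card-∅ : ∀ {n} → card {n} ∅ ≡ 0
card-∅ {n} = trans (count-cong {p = inS (∅ {n})} λ v → lookup-replicate v false) (count-false n)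

isolated-∅ : ∀ {n} (G : Graph n) → MinDegreeAtLeast G 1 → isolated G ∅ ≡ 0
isolated-∅ {n} G no-isolated = trans (count-cong {q = λ _ → false} not-isolated) (count-false n)
  where
  not-isolated : ∀ v → isolatedIn G ∅ v ≡ false
  not-isolated v with isolatedIn G ∅ v in iso
  ... | false = refl
  ... | true  = let w , vw = count>0⇒∃ (adj G v) (no-isolated v) in
    contradiction (trans (sym (lookup-replicate w false)) (isolatedIn-nbr G ∅ iso vw)) λ ()

even⇒GFC : ∀ {n k} {G : Graph n} → 1 ≤ k → 2 ∣ k → ¬ 2 ∣ n → MinDegreeAtLeast G 1 →
  (∀ S → ¬ BadSet G S) → GFC k G
even⇒GFC {n} {k} {G} k≥1 2∣k n-odd no-isolated no-bad-set = n-odd , ∅-barrier , only-∅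
  where
  card≤isolated⇒≡∅ : ∀ S → card S ≤ isolated G S → S ≡ ∅
  card≤isolated⇒≡∅ S |S|≤i = card≡0⇒≡∅ S (n≤0⇒n≡0 (≮⇒≥ λ |S|>0 → no-bad-set S (|S|>0 , |S|≤i)))
  isolated≤card : ∀ S → isolated G S ≤ card S
  isolated≤card S with card S ≤? isolated G S
  ... | no  |S|≰i = <⇒≤ (≰⇒> |S|≰i)
  ... | yes |S|≤i = subst (λ S → isolated G S ≤ card S) (sym (card≤isolated⇒≡∅ S |S|≤i))
                          (subst (_≤ card (∅ {n})) (sym (isolated-∅ G no-isolated)) z≤n)
  φ-∅ : φ k G ∅ ≡ ℤ.+ 0
  φ-∅ rewrite φ-even G ∅ 2∣k | isolated-∅ G no-isolated | card-∅ {n} | *-zeroʳ k = refl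
  ∅-barrier : IsBarrier k G ∅
  ∅-barrier T rewrite φ-∅ | φ-even G T 2∣k = i≤j⇒i-j≤0 (ℤ.+≤+ (*-monoʳ-≤ k (isolated≤card T)))
  only-∅ : ∀ S → IsBarrier k G S → S ≡ ∅
  only-∅ S barrier = card≤isolated⇒≡∅ S (*-cancelˡ-≤ k {{>-nonZero k≥1}}
    (drop‿+≤+ (0≤i-j⇒j≤i (subst₂ ℤ._≤_ φ-∅ (φ-even G S 2∣k) (barrier ∅)))))

theorem4p1 : (δ k n : ℕ) → 1 ≤ δ → 1 ≤ k → 2 ∣ k → ¬ (2 ∣ n) → 3 ≤ n →
    (G : Graph n) → Connected G → MinDegreeAtLeast G δ →
    (6 * δ ∸ 1 < n → edges (Kjoin n δ) ≤ edges G → ¬ Iso G (Kjoin n δ) → GFC k G)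
    × (n ≡ 6 * δ ∸ 1 → edges (Kjoin n δ) ≤ edges G → ¬ Iso G (Kjoin n δ) → ¬ Iso G (Ksplit n) → GFC k G)
    × (n < 6 * δ ∸ 1 → edges (Ksplit n) ≤ edges G → ¬ Iso G (Ksplit n) → GFC k G)
theorem4p1 δ k n δ≥1 k≥1 2∣k n-odd _ G _ δ≤deg =
    (λ 6δ-1<n eK≤eG G≇K → GFC-G λ S bad →
       G≇K (joinShape-6δ≤n (shape S bad) (subst (_≤ n) 1+[6δ∸1]≡6δ 6δ-1<n) eK≤eG))
  , (λ n≡6δ-1 eK≤eG G≇K G≇S → GFC-G λ S bad →
       [ G≇K , G≇S ]′ (joinShape-1+n≡6δ (shape S bad) (trans (cong suc n≡6δ-1) 1+[6δ∸1]≡6δ) eK≤eG))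
  , (λ n<6δ-1 eS≤eG G≇S → GFC-G λ S bad →
       G≇S (joinShape-n+2≤6δ (shape S bad) (subst (suc (suc n) ≤_) 1+[6δ∸1]≡6δ (s≤s n<6δ-1)) eS≤eG))
  where
  1+[6δ∸1]≡6δ : suc (6 * δ ∸ 1) ≡ 6 * δ
  1+[6δ∸1]≡6δ = suc[6δ∸1]≡6δ δ δ≥1
  GFC-G : (∀ S → ¬ BadSet G S) → GFC k G
  GFC-G = even⇒GFC k≥1 2∣k n-odd (λ v → ≤-trans δ≥1 (δ≤deg v))
  shape : ∀ S → BadSet G S → JoinShape G δ
  shape S = badSet⇒joinShape S n-odd δ≤deg
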